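{- Let $S$ be a semigroup and $x\in S$ a torsion element with known cycle length $L_x$ and order $N_x$. Consider the following procedure (exponentiations computed by repeated squaring). Set $s\leftarrow 1$; while $x^{s+L_x}\neq x^{s}$, set $s\leftarrow 2s$. Then set $a\leftarrow s/2$; while $|a-s|\ge 2$: set $c\leftarrow\lfloor (a+s)/2\rfloor$, and if $x^{c+L_x}\neq x^{c}$ set $a\leftarrow c$, otherwise set $s\leftarrow c$. Output $s$. This procedure requires $\mathcal{O}\left((\log N_x)^2\right)$ steps.
   Context: A semigroup is a set with an associative binary operation; $x\in S$ is torsion if $\langle x\rangle=\{x^k: k\ge1\}$ is finite. The cycle start $s_x$ is the smallest positive integer such that $x^{s_x}=x^b$ for some $b>s_x$; the cycle length $L_x$ is the smallest positive integer with $x^{s_x+L_x}=x^{s_x}$; the order is $N_x=|\langle x\rangle|=s_x+L_x-1$. A step is one semigroup multiplication or one equality comparison of semigroup elements; an exponentiation $x^e$ costs $\mathcal{O}(\log e)$ steps. -}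

module Defs where

open import Level using (Level; _⊔_)
open import Algebra.Bundles using (Semigroup)
open import Data.Nat using (ℕ; zero; suc; _+_; _*_; _≤_; _<_; ⌊_/2⌋; ∣_-_∣; _≤ᵇ_)
open import Data.Bool using (Bool; true; false; if_then_else_)
open import Data.Maybe using (Maybe; just; nothing)
open import Data.Product using (_×_; _,_; ∃)
open import Relation.Nullary using (¬_; does)
open import Relation.Binary.Definitions using (Decidable)

module _ {c ℓ : Level} (S : Semigroup c ℓ) where
  open Semigroup S

  -- pow x k = x^k for k ≥ 1 (the value at k = 0 is junk and never used)
  pow : Carrier → ℕ → Carrier
  pow x zero = x
  pow x (suc zero) = x
  pow x (suc (suc k)) = x ∙ pow x (suc k)

  IsCycleStart : Carrier → ℕ → Set ℓ
  IsCycleStart x s =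
    1 ≤ s × ∃ (λ b → s < b × pow x s ≈ pow x b)
    × (∀ t → 1 ≤ t → t < s → ¬ ∃ (λ b → t < b × pow x t ≈ pow x b))

  IsCycleLength : Carrier → ℕ → Set ℓ
  IsCycleLength x L = ∃ λ s → IsCycleStart x s × 1 ≤ L × pow x (s + L) ≈ pow x s
    × (∀ M → 1 ≤ M → M < L → ¬ pow x (s + M) ≈ pow x s)

  IsOrder : Carrier → ℕ → Set ℓ
  IsOrder x N =
    (∀ i j → 1 ≤ i → i < j → j ≤ N → ¬ pow x i ≈ pow x j)
    × (∀ k → 1 ≤ k → ∃ λ i → 1 ≤ i × i ≤ N × pow x k ≈ pow x i)

  -- Cost model: a computation returns its value together with the number of
  -- steps (semigroup multiplications + equality comparisons) it used.
  module Algorithm (_≟_ : Decidable _≈_) (x : Carrier) (L : ℕ) where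

    isEven : ℕ → Bool
    isEven zero = true
    isEven (suc zero) = false
    isEven (suc (suc n)) = isEven n

    -- x^e (e ≥ 1) by repeated squaring; fuel argument (e suffices) for termination
    sqpow : ℕ → ℕ → Carrier × ℕ
    sqpow zero e = x , 0
    sqpow (suc f) zero = x , 0
    sqpow (suc f) (suc zero) = x , 0
    sqpow (suc f) (suc (suc e)) with sqpow f ⌊ suc (suc e) /2⌋
    ... | y , k = if isEven e then (y ∙ y , suc k) else ((y ∙ y) ∙ x , suc (suc k))

    powSq : ℕ → Carrier × ℕ
    powSq e = sqpow e e

    test : ℕ → Bool × ℕ
    test t with powSq (t + L) | powSq t
    ... | u , k₁ | v , k₂ = does (u ≟ v) , suc (k₁ + k₂)

    loop1 : ℕ → ℕ → Maybe (ℕ × ℕ)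
    loop1 zero s = nothing
    loop1 (suc f) s with test s
    ... | true , k = just (s , k)
    ... | false , k with loop1 f (2 * s)
    ...   | nothing = nothing
    ...   | just (s' , k') = just (s' , k + k')

    loop2 : ℕ → ℕ → ℕ → Maybe (ℕ × ℕ)
    loop2 zero a s = nothing
    loop2 (suc f) a s with 2 ≤ᵇ ∣ a - s ∣
    ... | false = just (s , 0)
    ... | true with test ⌊ a + s /2⌋
    ...   | b , k with (if b then loop2 f a ⌊ a + s /2⌋ else loop2 f ⌊ a + s /2⌋ s)
    ...     | nothing = nothing
    ...     | just (s' , k') = just (s' , k + k')

    run : ℕ → Maybe (ℕ × ℕ)
    run f with loop1 f 1
    ... | nothing = nothing
    ... | just (s , k₁) with loop2 f ⌊ s /2⌋ s
    ...   | nothing = nothing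
    ...   | just (s' , k₂) = just (s' , k₁ + k₂)

-- The two loops only call the test "x^(t+L) = x^t", which holds for every t ≥ sₓ because
-- L is a period from the cycle start. As sₓ ≤ N and L ≤ N, the doubling loop stops after at
-- most 2 + ⌊log₂ N⌋ tests at some s ≤ 2^(1+⌊log₂ N⌋), and the bisection loop halves the gap
-- s - a each round, so it performs at most 1 + ⌊log₂ N⌋ tests. Every tested exponent is at
-- most 2^(2+⌊log₂ N⌋), so by repeated squaring each test costs O(log N) steps. The bounds
-- on sₓ and L come from writing x^(N+1) = x^i with i ≤ N: minimality of sₓ gives sₓ ≤ i, and
-- N + 1 - i is a period from i, which transported down to sₓ is at least L.
module Submission where

open import Defs
open import Level using (Level)
open import Algebra.Bundles using (Semigroup)
open import Data.Nat using (ℕ; _+_; _*_; _^_; _≤_)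
open import Data.Nat.Logarithm using (⌊log₂_⌋)
open import Data.Maybe using (just)
open import Data.Product using (_×_; _,_; ∃)
open import Relation.Binary.Definitions using (Decidable)
open import Relation.Binary.PropositionalEquality using (_≡_)

open import Data.Nat using (zero; suc; _∸_; z≤n; s≤s; >-nonZero; ⌊_/2⌋; ⌈_/2⌉; ∣_-_∣; _≤ᵇ_)
open import Data.Nat.Properties
open import Data.Nat.Logarithm using (⌊log₂⌋-mono-≤; ⌊log₂[2^n]⌋≡n)
open import Data.Nat.Logarithm.Core using (⌊log2⌋-acc-irrelevant)
open import Data.Nat.Tactic.RingSolver using (solve-∀)
open import Data.Bool using (true; false; if_then_else_; T)
open import Data.Unit using (tt)
open import Data.Product using (proj₁; proj₂)
open import Relation.Nullary using (contradiction; yes; no)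
open import Relation.Nullary.Decidable using (dec-true)
open import Relation.Binary.PropositionalEquality using (refl; sym; trans; cong; subst; module ≡-Reasoning)

⌊m+[m+n]/2⌋≡m+⌊n/2⌋ : ∀ m n → ⌊ m + (m + n) /2⌋ ≡ m + ⌊ n /2⌋
⌊m+[m+n]/2⌋≡m+⌊n/2⌋ zero    n = refl
⌊m+[m+n]/2⌋≡m+⌊n/2⌋ (suc m) n =
  trans (cong (λ k → ⌊ suc k /2⌋) (+-suc m (m + n))) (cong suc (⌊m+[m+n]/2⌋≡m+⌊n/2⌋ m n))

m+n≡⌊m+[m+n]/2⌋+⌈n/2⌉ : ∀ m n → m + n ≡ ⌊ m + (m + n) /2⌋ + ⌈ n /2⌉
m+n≡⌊m+[m+n]/2⌋+⌈n/2⌉ m n = begin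
  m + n                          ≡⟨ cong (m +_) (⌊n/2⌋+⌈n/2⌉≡n n) ⟨
  m + (⌊ n /2⌋ + ⌈ n /2⌉)        ≡⟨ +-assoc m ⌊ n /2⌋ ⌈ n /2⌉ ⟨
  m + ⌊ n /2⌋ + ⌈ n /2⌉          ≡⟨ cong (_+ ⌈ n /2⌉) (⌊m+[m+n]/2⌋≡m+⌊n/2⌋ m n) ⟨
  ⌊ m + (m + n) /2⌋ + ⌈ n /2⌉    ∎
  where open ≡-Reasoning

n≤2*m⇒⌈n/2⌉≤m : ∀ {m n} → n ≤ 2 * m → ⌈ n /2⌉ ≤ m
n≤2*m⇒⌈n/2⌉≤m {m} {n} n≤ =
  subst (⌈ n /2⌉ ≤_) (sym (n≡⌈n+n/2⌉ m)) (⌈n/2⌉-mono (subst (n ≤_) (cong (m +_) (+-identityʳ m)) n≤))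

⌊log₂[2+n]⌋≡1+⌊log₂[1+⌊n/2⌋]⌋ : ∀ n → ⌊log₂ suc (suc n) ⌋ ≡ suc ⌊log₂ suc ⌊ n /2⌋ ⌋
⌊log₂[2+n]⌋≡1+⌊log₂[1+⌊n/2⌋]⌋ n = cong suc (⌊log2⌋-acc-irrelevant (suc ⌊ n /2⌋))

k≤2*⌊log₂[1+⌊n/2⌋]⌋⇒2+k≤2*⌊log₂[2+n]⌋ : ∀ n {k} → k ≤ 2 * ⌊log₂ suc ⌊ n /2⌋ ⌋ →
                                        2 + k ≤ 2 * ⌊log₂ suc (suc n) ⌋
k≤2*⌊log₂[1+⌊n/2⌋]⌋⇒2+k≤2*⌊log₂[2+n]⌋ n {k} k≤ =
  subst (2 + k ≤_) (sym (trans (cong (2 *_) (⌊log₂[2+n]⌋≡1+⌊log₂[1+⌊n/2⌋]⌋ n)) (*-suc 2 _))) (s≤s (s≤s k≤))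

n≤2^k⇒⌊log₂n⌋≤k : ∀ {n} k → n ≤ 2 ^ k → ⌊log₂ n ⌋ ≤ k
n≤2^k⇒⌊log₂n⌋≤k k n≤ = ≤-trans (⌊log₂⌋-mono-≤ n≤) (≤-reflexive (⌊log₂[2^n]⌋≡n k))

n≤2^[1+⌊log₂n⌋] : ∀ n → n ≤ 2 ^ suc ⌊log₂ n ⌋
n≤2^[1+⌊log₂n⌋] n = ≮⇒≥ λ 2^<n → 1+n≰n (subst (_≤ ⌊log₂ n ⌋) (⌊log₂[2^n]⌋≡n (suc ⌊log₂ n ⌋))
  (⌊log₂⌋-mono-≤ (<⇒≤ 2^<n)))

m≤2^k⇒n≤2^k⇒m+n≤2^[1+k] : ∀ {m n} k → m ≤ 2 ^ k → n ≤ 2 ^ k → m + n ≤ 2 ^ suc k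
m≤2^k⇒n≤2^k⇒m+n≤2^[1+k] k m≤ n≤ =
  ≤-trans (+-mono-≤ m≤ n≤) (≤-reflexive (cong (2 ^ k +_) (sym (+-identityʳ (2 ^ k)))))

m≤m*2^n : ∀ m n → m ≤ m * 2 ^ n
m≤m*2^n m n = m≤m*n m (2 ^ n) {{m^n≢0 2 n}}

[2*m]*2^n≡m*2^[1+n] : ∀ m n → 2 * m * 2 ^ n ≡ m * 2 ^ suc n
[2*m]*2^n≡m*2^[1+n] m n = trans (cong (_* 2 ^ n) (*-comm 2 m)) (*-assoc m 2 (2 ^ n))

module Powers {c ℓ : Level} (S : Semigroup c ℓ) (x : Semigroup.Carrier S) where
  open Semigroup S renaming (refl to ≈-refl; sym to ≈-sym; trans to ≈-trans)
  open import Relation.Binary.Reasoning.Setoid setoid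

  x^_ : ℕ → Carrier
  x^_ = pow S x

  x^-cong : ∀ {m n} → m ≡ n → x^ m ≈ x^ n
  x^-cong refl = ≈-refl

  x^-+ : ∀ m n → 1 ≤ m → 1 ≤ n → x^ (m + n) ≈ x^ m ∙ x^ n
  x^-+ (suc zero)    (suc n) _ _   = ≈-refl
  x^-+ (suc (suc m)) n       _ n≥1 =
    ≈-trans (∙-congˡ (x^-+ (suc m) n (s≤s z≤n) n≥1)) (≈-sym (assoc x (x^ suc m) (x^ n)))

  x^-shift : ∀ d {m n} → 1 ≤ m → 1 ≤ n → x^ m ≈ x^ n → x^ (d + m) ≈ x^ (d + n)
  x^-shift zero    _   _   eq = eq
  x^-shift (suc d) {m} {n} m≥1 n≥1 eq = begin
    x^ (suc d + m)       ≈⟨ x^-+ (suc d) m (s≤s z≤n) m≥1 ⟩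
    x^ suc d ∙ x^ m      ≈⟨ ∙-congˡ eq ⟩
    x^ suc d ∙ x^ n      ≈⟨ x^-+ (suc d) n (s≤s z≤n) n≥1 ⟨
    x^ (suc d + n)       ∎

  _IsPeriodFrom_ : ℕ → ℕ → Set ℓ
  p IsPeriodFrom i = ∀ j → i ≤ j → x^ (j + p) ≈ x^ j

  isPeriodFrom : ∀ {i p} → 1 ≤ i → x^ (i + p) ≈ x^ i → p IsPeriodFrom i
  isPeriodFrom {i} {p} i≥1 eq j i≤j = begin
    x^ (j + p)             ≈⟨ x^-cong (trans (sym (+-assoc (j ∸ i) i p)) (cong (_+ p) (m∸n+n≡m i≤j))) ⟨
    x^ (j ∸ i + (i + p))   ≈⟨ x^-shift (j ∸ i) (≤-trans i≥1 (m≤m+n i p)) i≥1 eq ⟩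
    x^ (j ∸ i + i)         ≈⟨ x^-cong (m∸n+n≡m i≤j) ⟩
    x^ j                   ∎

  isPeriodFrom-* : ∀ {i p} k → p IsPeriodFrom i → (k * p) IsPeriodFrom i
  isPeriodFrom-* zero        _   j _   = x^-cong (+-identityʳ j)
  isPeriodFrom-* {i} {p} (suc k) per j i≤j = begin
    x^ (j + (p + k * p))   ≈⟨ x^-cong (+-assoc j p (k * p)) ⟨
    x^ (j + p + k * p)     ≈⟨ isPeriodFrom-* k per (j + p) (≤-trans i≤j (m≤m+n j p)) ⟩
    x^ (j + p)             ≈⟨ per j i≤j ⟩
    x^ j                   ∎

  -- Both periods recur at the common point j = s + i q, which lies above i.
  period-descends : ∀ {s q i p} → 1 ≤ s → 1 ≤ q → q IsPeriodFrom s → p IsPeriodFrom i →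
                    x^ (s + p) ≈ x^ s
  period-descends {s} {q} {i} {p} s≥1 q≥1 perq perp = begin
    x^ (s + p)   ≈⟨ x^-cong (+-comm s p) ⟩
    x^ (p + s)   ≈⟨ x^-shift p s≥1 (≤-trans s≥1 (m≤m+n s (i * q))) (≈-sym back) ⟩
    x^ (p + j)   ≈⟨ x^-cong (+-comm p j) ⟩
    x^ (j + p)   ≈⟨ perp j i≤j ⟩
    x^ j         ≈⟨ back ⟩
    x^ s         ∎
    where
    j : ℕ
    j = s + i * q
    i≤j : i ≤ j
    i≤j = ≤-trans (m≤m*n i q {{>-nonZero q≥1}}) (m≤n+m (i * q) s)
    back : x^ j ≈ x^ s
    back = isPeriodFrom-* i perq s ≤-refl

  cycleStart≤order : ∀ {s N} → IsCycleStart S x s → IsOrder S x N → s ≤ N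
  cycleStart≤order {N = N} (_ , _ , minimal) (_ , cover) with cover (suc N) (s≤s z≤n)
  ... | i , i≥1 , i≤N , eq =
    ≤-trans (≮⇒≥ λ i<s → minimal i i≥1 i<s (suc N , s≤s i≤N , ≈-sym eq)) i≤N

  -- If x^(N+1) = x^i with i ≤ N, then N + 1 - i ≤ N is a period from the cycle start.
  cycleLength≤order : ∀ {L N} → IsCycleLength S x L → IsOrder S x N → L ≤ N
  cycleLength≤order {N = N} (s , (s≥1 , _) , L≥1 , eqL , minimal) (_ , cover)
    with cover (suc N) (s≤s z≤n)
  ... | i , i≥1 , i≤N , eq = ≤-trans (≮⇒≥ λ p<L → minimal p p≥1 p<L p-at-s) (∸-monoʳ-≤ (suc N) i≥1)
    where
    p : ℕ
    p = suc N ∸ i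
    p≥1 : 1 ≤ p
    p≥1 = m<n⇒0<n∸m (s≤s i≤N)
    p-at-s : x^ (s + p) ≈ x^ s
    p-at-s = period-descends s≥1 L≥1 (isPeriodFrom s≥1 eqL)
      (isPeriodFrom i≥1 (≈-trans (x^-cong (m+[n∸m]≡n (m≤n⇒m≤1+n i≤N))) eq))

module Procedure {c ℓ : Level} (S : Semigroup c ℓ) (_≟_ : Decidable (Semigroup._≈_ S))
                 (x : Semigroup.Carrier S) (L : ℕ) where
  open Semigroup S renaming (refl to ≈-refl; sym to ≈-sym; trans to ≈-trans)
  open Powers S x
  open Algorithm S _≟_ x L
  open import Relation.Binary.Reasoning.Setoid setoid

  ⌊n/2⌋+⌊n/2⌋+parity≡n : ∀ n → ⌊ n /2⌋ + ⌊ n /2⌋ + (if isEven n then 0 else 1) ≡ n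
  ⌊n/2⌋+⌊n/2⌋+parity≡n zero          = refl
  ⌊n/2⌋+⌊n/2⌋+parity≡n (suc zero)    = refl
  ⌊n/2⌋+⌊n/2⌋+parity≡n (suc (suc n)) = cong suc (trans
    (cong (_+ (if isEven n then 0 else 1)) (+-suc ⌊ n /2⌋ ⌊ n /2⌋))
    (cong suc (⌊n/2⌋+⌊n/2⌋+parity≡n n)))

  sqpow-correct : ∀ f e → 1 ≤ e → e ≤ f → proj₁ (sqpow f e) ≈ x^ e
  sqpow-correct (suc f) (suc zero)    _ _ = ≈-refl
  sqpow-correct (suc f) (suc (suc e)) _ (s≤s e<f) with isEven e | ⌊n/2⌋+⌊n/2⌋+parity≡n (suc (suc e))
  ... | true  | eq = begin
    y ∙ y          ≈⟨ ∙-cong root root ⟩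
    x^ h ∙ x^ h    ≈⟨ x^-+ h h (s≤s z≤n) (s≤s z≤n) ⟨
    x^ (h + h)     ≈⟨ x^-cong (trans (sym (+-identityʳ (h + h))) eq) ⟩
    x^ suc (suc e) ∎
    where
    h : ℕ
    h = suc ⌊ e /2⌋
    y : Carrier
    y = proj₁ (sqpow f h)
    root : y ≈ x^ h
    root = sqpow-correct f h (s≤s z≤n) (≤-trans (s≤s (⌊n/2⌋≤n e)) e<f)
  ... | false | eq = begin
    y ∙ y ∙ x               ≈⟨ ∙-congʳ (∙-cong root root) ⟩
    x^ h ∙ x^ h ∙ x^ 1      ≈⟨ ∙-congʳ (x^-+ h h (s≤s z≤n) (s≤s z≤n)) ⟨
    x^ (h + h) ∙ x^ 1       ≈⟨ x^-+ (h + h) 1 (s≤s z≤n) (s≤s z≤n) ⟨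
    x^ (h + h + 1)          ≈⟨ x^-cong eq ⟩
    x^ suc (suc e)          ∎
    where
    h : ℕ
    h = suc ⌊ e /2⌋
    y : Carrier
    y = proj₁ (sqpow f h)
    root : y ≈ x^ h
    root = sqpow-correct f h (s≤s z≤n) (≤-trans (s≤s (⌊n/2⌋≤n e)) e<f)

  sqpow-steps : ∀ f e → proj₂ (sqpow f e) ≤ 2 * ⌊log₂ e ⌋
  sqpow-steps zero          _             = z≤n
  sqpow-steps (suc f)       zero          = z≤n
  sqpow-steps (suc f)       (suc zero)    = z≤n
  sqpow-steps (suc f) (suc (suc e)) with isEven e
  ... | true  = ≤-trans (n≤1+n _) (k≤2*⌊log₂[1+⌊n/2⌋]⌋⇒2+k≤2*⌊log₂[2+n]⌋ e (sqpow-steps f (suc ⌊ e /2⌋)))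
  ... | false = k≤2*⌊log₂[1+⌊n/2⌋]⌋⇒2+k≤2*⌊log₂[2+n]⌋ e (sqpow-steps f (suc ⌊ e /2⌋))

  test-true : ∀ t → 1 ≤ t → x^ (t + L) ≈ x^ t → proj₁ (test t) ≡ true
  test-true t t≥1 eq = dec-true (proj₁ (powSq (t + L)) ≟ proj₁ (powSq t)) (begin
    proj₁ (powSq (t + L)) ≈⟨ sqpow-correct (t + L) (t + L) (≤-trans t≥1 (m≤m+n t L)) ≤-refl ⟩
    x^ (t + L)            ≈⟨ eq ⟩
    x^ t                  ≈⟨ sqpow-correct t t t≥1 ≤-refl ⟨
    proj₁ (powSq t)       ∎)

  test-steps : ∀ t K → t + L ≤ 2 ^ K → proj₂ (test t) ≤ 1 + 4 * K
  test-steps t K t+L≤ =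
    s≤s (subst (proj₂ (powSq (t + L)) + proj₂ (powSq t) ≤_) (sym (*-distribʳ-+ K 2 2)) (+-mono-≤
    (≤-trans (sqpow-steps (t + L) (t + L)) (*-monoʳ-≤ 2 (n≤2^k⇒⌊log₂n⌋≤k K t+L≤)))
    (≤-trans (sqpow-steps t t) (*-monoʳ-≤ 2 (n≤2^k⇒⌊log₂n⌋≤k K (≤-trans (m≤m+n t L) t+L≤))))))

  module Loops {sₓ} (sₓ≥1 : 1 ≤ sₓ) (period : L IsPeriodFrom sₓ) where

    sₓ≤t⇒test-true : ∀ t → sₓ ≤ t → proj₁ (test t) ≡ true
    sₓ≤t⇒test-true t sₓ≤t = test-true t (≤-trans sₓ≥1 sₓ≤t) (period t sₓ≤t)

    module _ (K : ℕ) where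

      test≡⇒steps≤ : ∀ {t b k} → test t ≡ (b , k) → t + L ≤ 2 ^ K → k ≤ 1 + 4 * K
      test≡⇒steps≤ {t} eq bound = subst (_≤ 1 + 4 * K) (cong proj₂ eq) (test-steps t K bound)

      probe-bound : ∀ m t → t * 2 ^ m + L ≤ 2 ^ K → t + L ≤ 2 ^ K
      probe-bound m t bound = ≤-trans (+-monoˡ-≤ L (m≤m*2^n t m)) bound

      loop1-steps : ∀ m t → sₓ ≤ t * 2 ^ m → t * 2 ^ m + L ≤ 2 ^ K →
        ∃ λ t' → ∃ λ k → loop1 (suc m) t ≡ just (t' , k) × t' ≤ t * 2 ^ m × k ≤ suc m * (1 + 4 * K)
      loop1-steps m t sₓ≤ bound with test t in eq
      ... | true , k =
        t , k , refl , m≤m*2^n t m , ≤-trans (test≡⇒steps≤ eq (probe-bound m t bound)) (m≤m+n _ _)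
      loop1-steps zero t sₓ≤ bound | false , k
        with () ← trans (sym (cong proj₁ eq)) (sₓ≤t⇒test-true t (subst (sₓ ≤_) (*-identityʳ t) sₓ≤))
      loop1-steps (suc m) t sₓ≤ bound | false , k
        with loop1-steps m (2 * t) (subst (sₓ ≤_) (sym ([2*m]*2^n≡m*2^[1+n] t m)) sₓ≤)
                                   (subst (λ u → u + L ≤ 2 ^ K) (sym ([2*m]*2^n≡m*2^[1+n] t m)) bound)
      ... | t' , k' , e , t'≤ , k'≤ rewrite e =
        t' , k + k' , refl , subst (t' ≤_) ([2*m]*2^n≡m*2^[1+n] t m) t'≤ ,
        +-mono-≤ (test≡⇒steps≤ eq (probe-bound (suc m) t bound)) k'≤

      midpoint-bound : ∀ a d → a + d + L ≤ 2 ^ K → ⌊ a + (a + d) /2⌋ + L ≤ 2 ^ K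
      midpoint-bound a d bound = ≤-trans (+-monoˡ-≤ L (subst (_≤ a + d) (sym (⌊m+[m+n]/2⌋≡m+⌊n/2⌋ a d))
        (+-monoʳ-≤ a (⌊n/2⌋≤n d)))) bound

      loop2-steps : ∀ m a d b → b ≡ a + d → d ≤ 2 ^ m → b + L ≤ 2 ^ K →
        ∃ λ b' → ∃ λ k → loop2 (suc m) a b ≡ just (b' , k) × k ≤ m * (1 + 4 * K)
      loop2-steps m a d _ refl d≤ bound with 2 ≤ᵇ ∣ a - a + d ∣ in gap
      ... | false = a + d , 0 , refl , z≤n
      loop2-steps zero a d _ refl d≤1 bound | true = contradiction (≤-trans 2≤d d≤1) 1+n≰n
        where
        2≤d : 2 ≤ d
        2≤d = subst (2 ≤_) (∣m-m+n∣≡n a d) (≤ᵇ⇒≤ 2 _ (subst T (sym gap) tt))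
      -- The goal shows `test` unfolded, so we split on the comparison it performs.
      loop2-steps (suc m) a d _ refl d≤ bound | true
        with proj₁ (powSq (⌊ a + (a + d) /2⌋ + L)) ≟ proj₁ (powSq ⌊ a + (a + d) /2⌋)
      ... | yes _
        with loop2-steps m a ⌊ d /2⌋ _ (⌊m+[m+n]/2⌋≡m+⌊n/2⌋ a d)
               (≤-trans (⌊n/2⌋≤⌈n/2⌉ d) (n≤2*m⇒⌈n/2⌉≤m d≤)) (midpoint-bound a d bound)
      ...   | b' , k' , e , k'≤ rewrite e =
        b' , _ , refl , +-mono-≤ (test-steps _ K (midpoint-bound a d bound)) k'≤
      loop2-steps (suc m) a d _ refl d≤ bound | true | no _
        with loop2-steps m ⌊ a + (a + d) /2⌋ ⌈ d /2⌉ (a + d) (m+n≡⌊m+[m+n]/2⌋+⌈n/2⌉ a d)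
               (n≤2*m⇒⌈n/2⌉≤m d≤) bound
      ...   | b' , k' , e , k'≤ rewrite e =
        b' , _ , refl , +-mono-≤ (test-steps _ K (midpoint-bound a d bound)) k'≤

    run-steps : ∀ n → sₓ ≤ 2 ^ n → L ≤ 2 ^ n →
      ∃ λ out → ∃ λ steps → run (suc n) ≡ just (out , steps) ×
        steps ≤ suc n * (1 + 4 * suc n) + n * (1 + 4 * suc n)
    run-steps n sₓ≤ L≤
      with loop1-steps (suc n) n 1 (subst (sₓ ≤_) (sym (*-identityˡ _)) sₓ≤)
                           (m≤2^k⇒n≤2^k⇒m+n≤2^[1+k] n (≤-reflexive (*-identityˡ _)) L≤)
    ... | s , k₁ , e₁ , s≤ , k₁≤
      with loop2-steps (suc n) n ⌊ s /2⌋ ⌈ s /2⌉ s (sym (⌊n/2⌋+⌈n/2⌉≡n s))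
             (≤-trans (⌈n/2⌉≤n s) s≤2^n) (m≤2^k⇒n≤2^k⇒m+n≤2^[1+k] n s≤2^n L≤)
      where
      s≤2^n : s ≤ 2 ^ n
      s≤2^n = subst (s ≤_) (*-identityˡ _) s≤
    ...   | out , k₂ , e₂ , k₂≤ rewrite e₁ | e₂ = out , k₁ + k₂ , refl , +-mono-≤ k₁≤ k₂≤

-- What remains of 27 (1 + g)² after (2g + 3)(4g + 9) is the slack 19 g² + 24 g.
steps-quadratic : ∀ g → (2 + g) * (1 + 4 * (2 + g)) + (1 + g) * (1 + 4 * (2 + g)) ≤ 27 * (1 + g) ^ 2
steps-quadratic g = ≤-trans (m≤m+n _ (19 * (g * g) + 24 * g)) (≤-reflexive (expand g))
  where
  expand : ∀ g → (2 + g) * (1 + 4 * (2 + g)) + (1 + g) * (1 + 4 * (2 + g)) + (19 * (g * g) + 24 * g)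
               ≡ 27 * ((1 + g) * ((1 + g) * 1))
  expand = solve-∀

lemma3 : ∀ {c ℓ : Level} → ∃ λ (C : ℕ) →
  ∀ (S : Semigroup c ℓ) (_≟_ : Decidable (Semigroup._≈_ S))
    (x : Semigroup.Carrier S) (L N : ℕ) →
    IsCycleLength S x L → IsOrder S x N →
    ∃ λ fuel → ∃ λ out → ∃ λ steps →
      Algorithm.run S _≟_ x L fuel ≡ just (out , steps)
      × steps ≤ C * (1 + ⌊log₂ N ⌋) ^ 2
lemma3 = 27 , λ where
  S _≟_ x L N cycle@(_ , start@(sₓ≥1 , _) , _ , periodic , _) order →
    let open Powers S x
        open Procedure S _≟_ x L
        open Loops sₓ≥1 (isPeriodFrom sₓ≥1 periodic)
        g : ℕ
        g = ⌊log₂ N ⌋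
        N≤2^[1+g] : N ≤ 2 ^ suc g
        N≤2^[1+g] = n≤2^[1+⌊log₂n⌋] N
        (out , steps , ran , steps≤) = run-steps (suc g)
          (≤-trans (cycleStart≤order start order) N≤2^[1+g])
          (≤-trans (cycleLength≤order cycle order) N≤2^[1+g])
    in 2 + g , out , steps , ran , ≤-trans steps≤ (steps-quadratic g)
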